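{- In a split graph, if $Q$ is a clique, then every vertex in $C$ has a neighbor in $I$. If $Q$ is an independent set, then every vertex in $I$ has a non-neighbor in $C$.
   Context: A split graph is a graph whose vertex set can be partitioned into a clique and an independent set (parts may be empty); such an ordered pair $(C',I')$ (clique, independent set) is a split partition. For a split graph $G$: the always-clique set $C$ is the set of vertices lying in the clique of every split partition; the always-independent set $I$ is the set of vertices lying in the independent set of every split partition; the questioning set $Q$ is the set of vertices $v$ for which some split partition places $v$ in the clique and some split partition places $v$ in the independent set. -}

module Defs where

open import Data.Nat using (ℕ)
open import Data.Fin using (Fin)
open import Data.Bool using (Bool; true; false)
open import Data.Product using (_×_; ∃-syntax)
open import Relation.Binary.PropositionalEquality using (_≡_)
open import Relation.Nullary using (¬_; Dec)

record Graph (n : ℕ) : Set₁ where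
  field
    Adj    : Fin n → Fin n → Set
    adj?   : ∀ u v → Dec (Adj u v)
    sym    : ∀ {u v} → Adj u v → Adj v u
    irrefl : ∀ {u} → ¬ Adj u u
open Graph public

module _ {n : ℕ} (G : Graph n) where

  IsClique : (Fin n → Set) → Set
  IsClique S = ∀ u v → S u → S v → ¬ u ≡ v → Adj G u v

  IsIndependent : (Fin n → Set) → Set
  IsIndependent S = ∀ u v → S u → S v → ¬ Adj G u v

  -- A split partition (C', I') is encoded by its characteristic function
  -- p : Fin n → Bool (true = in the clique part C', false = in the independent part I').
  IsSplitPartition : (Fin n → Bool) → Set
  IsSplitPartition p = IsClique (λ v → p v ≡ true) × IsIndependent (λ v → p v ≡ false)

  IsSplitGraph : Set
  IsSplitGraph = ∃[ p ] IsSplitPartition p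

  InC : Fin n → Set
  InC v = ∀ p → IsSplitPartition p → p v ≡ true

  InI : Fin n → Set
  InI v = ∀ p → IsSplitPartition p → p v ≡ false

  InQ : Fin n → Set
  InQ v = (∃[ p ] (IsSplitPartition p × p v ≡ true))
        × (∃[ p ] (IsSplitPartition p × p v ≡ false))

-- Fix a split partition (K, S). A vertex v of C has a neighbour in S, otherwise moving v to S
-- would give a split partition with v outside the clique. Take such a neighbour u. Whether u lies
-- in I is decidable: u can enter the clique of some split partition exactly when
-- ({u} ∪ (K ∩ N(u)), rest) is one. If u ∈ Q and Q is a clique, every vertex of K not adjacent
-- to u would also lie in Q, so u is adjacent to all of K and (K + u, S - u) is split. There v
-- again has a neighbour u′ in S - u; if u′ were in Q too, the clique Q would join u and u′
-- inside the independent set S. The second statement is the first one for the complement graph,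
-- which exchanges C and I and keeps Q.
module Submission where

open import Defs
open import Data.Nat using (ℕ)
open import Data.Fin using (Fin; _≟_)
open import Data.Fin.Properties using (any?; all?)
open import Data.Bool using (Bool; true; false; not; if_then_else_; _∧_)
open import Data.Bool.Properties using (not-injective; not-¬; ¬-not) renaming (_≟_ to _≟ᵇ_)
open import Data.Vec.Functional using (updateAt)
open import Data.Vec.Functional.Properties using (updateAt-updates; updateAt-minimal)
open import Data.Sum using (_⊎_; inj₁; inj₂)
open import Data.Product using (_×_; _,_; ∃-syntax; proj₁; proj₂)
open import Function using (_∘_; const)
open import Relation.Nullary using (¬_; Dec; yes; no; does; contradiction)
open import Relation.Nullary.Decidable using (_→-dec_; _×-dec_; ¬?; decidable-stable)
open import Relation.Binary.PropositionalEquality using (_≡_; _≢_; refl; trans; cong; ≢-sym) renaming (sym to ≡-sym)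

private
  variable
    n : ℕ

_[_≔_] : (Fin n → Bool) → Fin n → Bool → Fin n → Bool
p [ v ≔ b ] = updateAt p v (const b)

[≔]-updates : (p : Fin n → Bool) (v : Fin n) (b : Bool) → (p [ v ≔ b ]) v ≡ b
[≔]-updates p v b = updateAt-updates v p

[≔]-inv : ∀ (p : Fin n → Bool) v b y {c} → (p [ v ≔ b ]) y ≡ c
        → (y ≡ v × b ≡ c) ⊎ (y ≢ v × p y ≡ c)
[≔]-inv p v b y py≡c with y ≟ v
... | yes refl = inj₁ (refl , trans (≡-sym ([≔]-updates p v b)) py≡c)
... | no y≢v = inj₂ (y≢v , trans (≡-sym (updateAt-minimal y v p y≢v)) py≡c)

module _ (G : Graph n) where

  isSplitPartition? : ∀ p → Dec (IsSplitPartition G p)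
  isSplitPartition? p =
    all? (λ u → all? (λ v → (p u ≟ᵇ true) →-dec ((p v ≟ᵇ true) →-dec (¬? (u ≟ v) →-dec adj? G u v))))
    ×-dec
    all? (λ u → all? (λ v → (p u ≟ᵇ false) →-dec ((p v ≟ᵇ false) →-dec ¬? (adj? G u v))))

  reassign-split : ∀ {p} → IsSplitPartition G p → (q : Fin n → Bool)
    → (∀ y z → p y ≡ false → q y ≡ true → q z ≡ true → y ≢ z → Adj G y z)
    → (∀ y z → p y ≡ true → q y ≡ false → q z ≡ false → ¬ Adj G y z)
    → IsSplitPartition G q
  reassign-split {p} (p-clique , p-independent) q joiners leavers = q-clique , q-independent
    where
    q-clique : IsClique G (λ y → q y ≡ true)
    q-clique y z qy qz y≢z with p y in py | p z in pz
    ... | false | _     = joiners y z py qy qz y≢z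
    ... | true  | false = sym G (joiners z y pz qz qy (≢-sym y≢z))
    ... | true  | true  = p-clique y z py pz y≢z
    q-independent : IsIndependent G (λ y → q y ≡ false)
    q-independent y z qy qz with p y in py | p z in pz
    ... | true  | _     = leavers y z py qy qz
    ... | false | true  = leavers z y pz qz qy ∘ sym G
    ... | false | false = p-independent y z py pz

  pullIntoClique : (Fin n → Bool) → Fin n → Fin n → Bool
  pullIntoClique p u y = if does (y ≟ u) then true else p y ∧ does (adj? G u y)

  pullIntoClique-self : ∀ p u → pullIntoClique p u u ≡ true
  pullIntoClique-self p u with u ≟ u
  ... | yes _   = refl
  ... | no u≢u = contradiction refl u≢u

  pullIntoClique-true : ∀ p u y → pullIntoClique p u y ≡ true → y ≡ u ⊎ (p y ≡ true × Adj G u y)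
  pullIntoClique-true p u y eq with y ≟ u | p y | adj? G u y
  ... | yes y≡u | _ | _ = inj₁ y≡u
  ... | no _ | true | yes uy = inj₂ (refl , uy)

  pullIntoClique-false : ∀ p u y → pullIntoClique p u y ≡ false
    → y ≢ u × (p y ≡ false ⊎ ¬ Adj G u y)
  pullIntoClique-false p u y eq with y ≟ u | p y | adj? G u y
  ... | no y≢u | false | _ = y≢u , inj₁ refl
  ... | no y≢u | true | no ¬uy = y≢u , inj₂ ¬uy

  -- The vertices left out of {u} ∪ (K ∩ N(u)) lie outside the clique of every split
  -- partition whose clique contains u.
  pullIntoClique-split : ∀ {p q u} → IsSplitPartition G p → p u ≡ false
    → IsSplitPartition G q → q u ≡ true → IsSplitPartition G (pullIntoClique p u)
  pullIntoClique-split {p} {q} {u} p-split pu (q-clique , q-independent) qu =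
    reassign-split p-split (pullIntoClique p u) joiners leavers
    where
    joiners : ∀ y z → p y ≡ false → pullIntoClique p u y ≡ true → pullIntoClique p u z ≡ true
      → y ≢ z → Adj G y z
    joiners y z py ry rz y≢z with pullIntoClique-true p u y ry | pullIntoClique-true p u z rz
    ... | inj₁ refl | inj₁ refl       = contradiction refl y≢z
    ... | inj₁ refl | inj₂ (_ , uz)   = uz
    ... | inj₂ (py′ , _) | _          = contradiction py′ (not-¬ py)
    outside-q : ∀ y → pullIntoClique p u y ≡ false → q y ≡ false
    outside-q y ry with pullIntoClique-false p u y ry
    ... | y≢u , inj₁ py = ¬-not λ qy → proj₂ p-split u y pu py (q-clique u y qu qy (≢-sym y≢u))
    ... | y≢u , inj₂ ¬uy = ¬-not λ qy → ¬uy (q-clique u y qu qy (≢-sym y≢u))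
    leavers : ∀ y z → p y ≡ true → pullIntoClique p u y ≡ false → pullIntoClique p u z ≡ false
      → ¬ Adj G y z
    leavers y z _ ry rz = q-independent y z (outside-q y ry) (outside-q z rz)

  InI⊎InQ : ∀ {p u} → IsSplitPartition G p → p u ≡ false → InI G u ⊎ InQ G u
  InI⊎InQ {p} {u} p-split pu with isSplitPartition? (pullIntoClique p u)
  ... | yes r-split = inj₂ ((pullIntoClique p u , r-split , pullIntoClique-self p u) , (p , p-split , pu))
  ... | no ¬r-split = inj₁ λ q q-split → ¬-not λ qu → ¬r-split (pullIntoClique-split p-split pu q-split qu)

  moveToIndependent-split : ∀ {p} → IsSplitPartition G p → ∀ v
    → (∀ u → p u ≡ false → ¬ Adj G v u) → IsSplitPartition G (p [ v ≔ false ])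
  moveToIndependent-split {p} p-split v isolated = reassign-split p-split (p [ v ≔ false ]) joiners leavers
    where
    joiners : ∀ y z → p y ≡ false → (p [ v ≔ false ]) y ≡ true → (p [ v ≔ false ]) z ≡ true
      → y ≢ z → Adj G y z
    joiners y z py qy _ _ with [≔]-inv p v false y qy
    ... | inj₂ (_ , py′) = contradiction py′ (not-¬ py)
    leavers : ∀ y z → p y ≡ true → (p [ v ≔ false ]) y ≡ false → (p [ v ≔ false ]) z ≡ false
      → ¬ Adj G y z
    leavers y z py qy qz with [≔]-inv p v false y qy | [≔]-inv p v false z qz
    ... | inj₂ (_ , py′) | _ = contradiction py′ (not-¬ py)
    ... | inj₁ (refl , _) | inj₁ (refl , _) = irrefl G
    ... | inj₁ (refl , _) | inj₂ (_ , pz) = isolated z pz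

  moveToClique-split : ∀ {p} → IsSplitPartition G p → ∀ u
    → (∀ x → p x ≡ true → Adj G u x) → IsSplitPartition G (p [ u ≔ true ])
  moveToClique-split {p} p-split u dominating = reassign-split p-split (p [ u ≔ true ]) joiners leavers
    where
    joiners : ∀ y z → p y ≡ false → (p [ u ≔ true ]) y ≡ true → (p [ u ≔ true ]) z ≡ true
      → y ≢ z → Adj G y z
    joiners y z py qy qz y≢z with [≔]-inv p u true y qy | [≔]-inv p u true z qz
    ... | inj₂ (_ , py′) | _ = contradiction py′ (not-¬ py)
    ... | inj₁ (refl , _) | inj₁ (refl , _) = contradiction refl y≢z
    ... | inj₁ (refl , _) | inj₂ (_ , pz) = dominating z pz
    leavers : ∀ y z → p y ≡ true → (p [ u ≔ true ]) y ≡ false → (p [ u ≔ true ]) z ≡ false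
      → ¬ Adj G y z
    leavers y z py qy _ with [≔]-inv p u true y qy
    ... | inj₂ (_ , py′) = contradiction py′ (not-¬ py)

  InC-has-independent-neighbour : ∀ {p v} → IsSplitPartition G p → InC G v
    → ∃[ u ] (p u ≡ false × Adj G v u)
  InC-has-independent-neighbour {p} {v} p-split v∈C
    with any? (λ u → (p u ≟ᵇ false) ×-dec adj? G v u)
  ... | yes neighbour = neighbour
  ... | no ¬neighbour = contradiction (v∈C _ moved-split) (not-¬ ([≔]-updates p v false))
    where
    moved-split : IsSplitPartition G (p [ v ≔ false ])
    moved-split = moveToIndependent-split p-split v λ u pu vu → ¬neighbour (u , pu , vu)

  -- A vertex x of K not adjacent to u must leave the clique whenever u enters it, so x ∈ Q.
  InQ-dominates-clique : ∀ {p u} → IsClique G (InQ G) → IsSplitPartition G p → InQ G u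
    → p u ≡ false → ∀ x → p x ≡ true → Adj G u x
  InQ-dominates-clique {p} {u} Q-clique p-split u∈Q@((q , q-split , qu) , _) pu x px =
    decidable-stable (adj? G u x) λ ¬ux → ¬ux (Q-clique u x u∈Q (x∈Q ¬ux) u≢x)
    where
    u≢x : u ≢ x
    u≢x u≡x = not-¬ pu (trans (cong p u≡x) px)
    x∈Q : ¬ Adj G u x → InQ G x
    x∈Q ¬ux = (p , p-split , px) , (q , q-split , ¬-not λ qx → ¬ux (proj₁ q-split u x qu qx u≢x))

  InC-has-InI-neighbour : IsSplitGraph G → IsClique G (InQ G)
    → ∀ v → InC G v → ∃[ w ] (InI G w × Adj G v w)
  InC-has-InI-neighbour (p , p-split) Q-clique v v∈C
    with InC-has-independent-neighbour p-split v∈C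
  ... | u , pu , vu with InI⊎InQ p-split pu
  ...   | inj₁ u∈I = u , u∈I , vu
  ...   | inj₂ u∈Q with InC-has-independent-neighbour (moveToClique-split p-split u dominating) v∈C
    where
    dominating : ∀ x → p x ≡ true → Adj G u x
    dominating = InQ-dominates-clique Q-clique p-split u∈Q pu
  ...     | u′ , p′u′ , vu′ with [≔]-inv p u true u′ p′u′
  ...       | inj₂ (u′≢u , pu′) with InI⊎InQ p-split pu′
  ...         | inj₁ u′∈I = u′ , u′∈I , vu′
  ...         | inj₂ u′∈Q = contradiction (Q-clique u u′ u∈Q u′∈Q (≢-sym u′≢u)) (proj₂ p-split u u′ pu pu′)

complement : Graph n → Graph n
complement G = record
  { Adj    = λ u v → u ≢ v × ¬ Adj G u v
  ; adj?   = λ u v → ¬? (u ≟ v) ×-dec ¬? (adj? G u v)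
  ; sym    = λ (u≢v , ¬uv) → ≢-sym u≢v , ¬uv ∘ sym G
  ; irrefl = λ (u≢u , _) → u≢u refl
  }

module _ (G : Graph n) where

  private
    Gᶜ = complement G

    not≡true : ∀ {b} → not b ≡ true → b ≡ false
    not≡true = not-injective

    not≡false : ∀ {b} → not b ≡ false → b ≡ true
    not≡false = not-injective

  split-complement : ∀ {p} → IsSplitPartition G p → IsSplitPartition Gᶜ (not ∘ p)
  split-complement {p} (clique , independent) = clique′ , independent′
    where
    clique′ : IsClique Gᶜ (λ v → not (p v) ≡ true)
    clique′ u v pu pv u≢v = u≢v , independent u v (not≡true pu) (not≡true pv)
    independent′ : IsIndependent Gᶜ (λ v → not (p v) ≡ false)
    independent′ u v pu pv (u≢v , ¬uv) = ¬uv (clique u v (not≡false pu) (not≡false pv) u≢v)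

  split-uncomplement : ∀ {p} → IsSplitPartition Gᶜ p → IsSplitPartition G (not ∘ p)
  split-uncomplement {p} (clique , independent) = clique′ , independent′
    where
    clique′ : IsClique G (λ v → not (p v) ≡ true)
    clique′ u v pu pv u≢v =
      decidable-stable (adj? G u v) λ ¬uv → independent u v (not≡true pu) (not≡true pv) (u≢v , ¬uv)
    independent′ : IsIndependent G (λ v → not (p v) ≡ false)
    independent′ u v pu pv uv =
      proj₂ (clique u v (not≡false pu) (not≡false pv) λ { refl → irrefl G uv }) uv

  InI⇒InC-complement : ∀ {v} → InI G v → InC Gᶜ v
  InI⇒InC-complement v∈I p p-split = not≡false (v∈I (not ∘ p) (split-uncomplement p-split))

  InI-complement⇒InC : ∀ {v} → InI Gᶜ v → InC G v
  InI-complement⇒InC v∈Iᶜ p p-split = not≡false (v∈Iᶜ (not ∘ p) (split-complement p-split))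

  InQ-complement⇒InQ : ∀ {v} → InQ Gᶜ v → InQ G v
  InQ-complement⇒InQ ((p , p-split , pv) , (q , q-split , qv)) =
    (not ∘ q , split-uncomplement q-split , cong not qv) , (not ∘ p , split-uncomplement p-split , cong not pv)

  InI-has-InC-non-neighbour : IsSplitGraph G → IsIndependent G (InQ G)
    → ∀ v → InI G v → ∃[ w ] (InC G w × ¬ Adj G v w)
  InI-has-InC-non-neighbour (p , p-split) Q-independent v v∈I
    with InC-has-InI-neighbour Gᶜ (not ∘ p , split-complement p-split) Qᶜ-clique v (InI⇒InC-complement v∈I)
    where
    Qᶜ-clique : IsClique Gᶜ (InQ Gᶜ)
    Qᶜ-clique u w u∈Q w∈Q u≢w = u≢w , Q-independent u w (InQ-complement⇒InQ u∈Q) (InQ-complement⇒InQ w∈Q)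
  ... | w , w∈Iᶜ , (_ , ¬vw) = w , InI-complement⇒InC w∈Iᶜ , ¬vw

lemma7p5 : ∀ {n : ℕ} (G : Graph n) → IsSplitGraph G
    → (IsClique G (InQ G) → ∀ v → InC G v → ∃[ w ] (InI G w × Adj G v w))
    × (IsIndependent G (InQ G) → ∀ v → InI G v → ∃[ w ] (InC G w × ¬ Adj G v w))
lemma7p5 G split-graph = InC-has-InI-neighbour G split-graph , InI-has-InC-non-neighbour G split-graph
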